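{- Let $q$ be an odd positive integer. Every Dehn-Sommerville $q$-manifold $G$ has Euler characteristic $\chi(G)=0$. Consequently, every odd-dimensional Dehn-Sommerville $q$-manifold is a Dehn-Sommerville $q$-sphere.
   Context: A finite abstract simplicial complex $G$ is a finite set of non-empty finite sets closed under taking non-empty subsets. For $x\in G$, $\dim(x)=|x|-1$ and $\omega(x)=(-1)^{\dim(x)}$; for $A\subset G$, $\chi(A)=\sum_{x\in A}\omega(x)$. The star of $x\in G$ is $U(x)=\{y\in G: x\subset y\}$; its closure is $\overline{U(x)}=\{z\in G: z\subset y \text{ for some } y\in U(x)\}$, and the unit sphere is the subcomplex $S(x)=\overline{U(x)}\setminus U(x)$. The void $0=\emptyset$ (empty complex) is by definition the Dehn-Sommerville $(-1)$-sphere. Inductively, for $q\ge 0$, a non-empty complex $G$ is a Dehn-Sommerville $q$-manifold if every unit sphere $S(x)$, $x\in G$, is a Dehn-Sommerville $(q-1)$-sphere; a Dehn-Sommerville $q$-sphere is a Dehn-Sommerville $q$-manifold $G$ with $\chi(G)=1+(-1)^q$. -}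

module Defs where

open import Data.Bool using (Bool; true; false; _∧_; not; if_then_else_)
open import Data.Nat using (ℕ; zero; suc; _∸_)
open import Data.Integer using (ℤ; +_; -_; _+_; -1ℤ; 1ℤ; 0ℤ; _^_)
open import Data.Fin using (Fin)
open import Data.Fin.Subset using (Subset; _⊆_; _∈_; ∣_∣; inside; outside)
open import Data.Fin.Subset.Properties using (_⊆?_)
open import Data.List using (List; []; _∷_; map; _++_; foldr)
open import Data.Bool.ListAction using (any)
open import Data.Vec using (_∷_; [])
open import Data.Product using (_×_; ∃)
open import Relation.Binary.PropositionalEquality using (_≡_)
open import Relation.Nullary.Decidable using (⌊_⌋)

-- Vertices are Fin n; a simplex is a subset of Fin n (Subset n = Vec Bool n).
-- A (finite) set of simplices is given by its characteristic function.
Family : ℕ → Set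
Family n = Subset n → Bool

allSubsets : (n : ℕ) → List (Subset n)
allSubsets zero = [] ∷ []
allSubsets (suc n) = map (outside ∷_) (allSubsets n) ++ map (inside ∷_) (allSubsets n)

IsComplex : ∀ {n} → Family n → Set
IsComplex {n} G =
  (∀ x → G x ≡ true → ∃ λ v → v ∈ x) ×
  (∀ x y → G x ≡ true → y ⊆ x → (∃ λ v → v ∈ y) → G y ≡ true)

ω : ∀ {n} → Subset n → ℤ
ω x = (-1ℤ) ^ (∣ x ∣ ∸ 1)

χ : ∀ {n} → Family n → ℤ
χ {n} A = foldr (λ x acc → (if A x then ω x else 0ℤ) + acc) 0ℤ (allSubsets n)

U : ∀ {n} → Family n → Subset n → Family n
U G x y = G y ∧ ⌊ x ⊆? y ⌋

Ubar : ∀ {n} → Family n → Subset n → Family n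
Ubar {n} G x z = G z ∧ any (λ y → U G x y ∧ ⌊ z ⊆? y ⌋) (allSubsets n)

S : ∀ {n} → Family n → Subset n → Family n
S G x z = Ubar G x z ∧ not (U G x z)

-- DSSphere k G  means  "G is a Dehn-Sommerville (k-1)-sphere"  (index shifted so that
-- k = 0 is the (-1)-sphere, the void).  DSManifold q G = "G is a Dehn-Sommerville q-manifold".
mutual
  DSSphere : ∀ {n} → ℕ → Family n → Set
  DSSphere zero G = ∀ x → G x ≡ false
  DSSphere (suc q) G = DSManifold q G × χ G ≡ 1ℤ + (-1ℤ) ^ q

  DSManifold : ∀ {n} → ℕ → Family n → Set
  DSManifold q G = (∃ λ x → G x ≡ true) × (∀ x → G x ≡ true → DSSphere q (S G x))

-- For a simplex x of G and a vertex v of x, toggling v is an involution on the closed star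
-- Ū(x) that changes the dimension by one; it cancels all terms of χ(Ū(x)) except that of the
-- vertex {v}, so χ(U(x)) + χ(S(x)) = χ(Ū(x)) = 1. The faces of a simplex y cancel in the same
-- way, so counting pairs x ⊆ y of simplices with weight ω(x)ω(y) in two ways gives
-- Σ_x ω(x)χ(U(x)) = χ(G). In an odd-dimensional Dehn-Sommerville manifold every unit sphere is
-- an even-dimensional sphere, so χ(S(x)) = 2, χ(U(x)) = -1, and hence χ(G) = -χ(G).
module Submission where

open import Defs
open import Data.Nat using (ℕ; zero; suc; _%_; _∸_; _<ᵇ_)
open import Data.Integer using (ℤ; +0; +[1+_]; -[1+_]; 0ℤ; 1ℤ; -1ℤ; _+_; -_; _*_; _^_)
import Data.Integer.Properties as ℤ
open import Algebra.Bundles using (AbelianGroup)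
open import Algebra.Properties.CommutativeSemigroup ℤ.+-commutativeSemigroup using (interchange)
open import Algebra.Properties.Group (AbelianGroup.group ℤ.+-0-abelianGroup) using (∙-cancelʳ)
open import Data.Bool using (Bool; true; false; _∧_; _∨_; not; if_then_else_)
open import Data.Bool.Properties using (T-≡; ∨-zeroʳ; ∧-conicalˡ; ∧-conicalʳ)
open import Data.Fin using (Fin; zero; suc)
open import Data.Fin.Subset using (Subset; inside; outside; ∣_∣; _∪_; _⊆_; _∈_; ⊥)
open import Data.Fin.Subset.Properties using (_⊆?_; p⊆p∪q; q⊆p∪q; x∈p∪q⁻; ⊥⊆; ∪-identityˡ)
open import Data.Vec using ([]; _∷_; here; there; insertAt; removeAt)
open import Data.Vec.Properties using (insertAt-removeAt; []=⇒lookup)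
open import Data.List using (List; []; _∷_; map; _++_; foldr)
open import Data.List.Membership.Propositional using (lose) renaming (_∈_ to _∈ₗ_)
open import Data.List.Membership.Propositional.Properties using (∈-++⁺ˡ; ∈-++⁺ʳ; ∈-map⁺)
import Data.List.Relation.Unary.Any as Any
open import Data.List.Relation.Unary.Any.Properties using (any⁺; any⁻)
open import Data.Product using (_×_; _,_; proj₁; proj₂; ∃)
open import Data.Sum using ([_,_]′)
open import Function using (_∘_; Equivalence)
open import Relation.Binary.PropositionalEquality
  using (_≡_; refl; sym; trans; cong; cong₂; module ≡-Reasoning)
open import Relation.Nullary.Decidable using (⌊_⌋; does; isYes≗does; dec-true; toWitness)

open Equivalence using (to; from)

sumList : {A : Set} → List A → (A → ℤ) → ℤ
sumList xs f = foldr (λ x acc → f x + acc) 0ℤ xs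

sumSubsets : ∀ n → (Subset n → ℤ) → ℤ
sumSubsets n = sumList (allSubsets n)

sumList-++ : {A : Set} (xs ys : List A) (f : A → ℤ) →
  sumList (xs ++ ys) f ≡ sumList xs f + sumList ys f
sumList-++ [] ys f = sym (ℤ.+-identityˡ _)
sumList-++ (x ∷ xs) ys f = trans (cong (f x +_) (sumList-++ xs ys f)) (sym (ℤ.+-assoc (f x) _ _))

sumList-map : {A B : Set} (g : A → B) (xs : List A) (f : B → ℤ) →
  sumList (map g xs) f ≡ sumList xs (f ∘ g)
sumList-map g [] f = refl
sumList-map g (x ∷ xs) f = cong (f (g x) +_) (sumList-map g xs f)

sumList-cong : {A : Set} (xs : List A) {f g : A → ℤ} → (∀ x → f x ≡ g x) → sumList xs f ≡ sumList xs g
sumList-cong [] f≗g = refl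
sumList-cong (x ∷ xs) f≗g = cong₂ _+_ (f≗g x) (sumList-cong xs f≗g)

sumList-0 : {A : Set} (xs : List A) → sumList xs (λ _ → 0ℤ) ≡ 0ℤ
sumList-0 [] = refl
sumList-0 (x ∷ xs) = trans (ℤ.+-identityˡ _) (sumList-0 xs)

sumList-+ : {A : Set} (xs : List A) (f g : A → ℤ) →
  sumList xs (λ x → f x + g x) ≡ sumList xs f + sumList xs g
sumList-+ [] f g = refl
sumList-+ (x ∷ xs) f g = trans (cong (f x + g x +_) (sumList-+ xs f g)) (interchange (f x) (g x) _ _)

sumList-*ˡ : {A : Set} (xs : List A) (c : ℤ) (f : A → ℤ) → sumList xs (λ x → c * f x) ≡ c * sumList xs f
sumList-*ˡ [] c f = sym (ℤ.*-zeroʳ c)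
sumList-*ˡ (x ∷ xs) c f =
  trans (cong (c * f x +_) (sumList-*ˡ xs c f)) (sym (ℤ.*-distribˡ-+ c (f x) _))

sumList-*ʳ : {A : Set} (xs : List A) (c : ℤ) (f : A → ℤ) → sumList xs (λ x → f x * c) ≡ sumList xs f * c
sumList-*ʳ xs c f = trans (sumList-cong xs (λ x → ℤ.*-comm (f x) c))
                          (trans (sumList-*ˡ xs c f) (ℤ.*-comm c _))

sumList-comm : {A B : Set} (xs : List A) (ys : List B) (f : A → B → ℤ) →
  sumList xs (λ x → sumList ys (f x)) ≡ sumList ys (λ y → sumList xs (λ x → f x y))
sumList-comm [] ys f = sym (sumList-0 ys)
sumList-comm (x ∷ xs) ys f =
  trans (cong (sumList ys (f x) +_) (sumList-comm xs ys f))
        (sym (sumList-+ ys (f x) (λ y → sumList xs (λ x′ → f x′ y))))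

sumSubsets-suc : ∀ n (f : Subset (suc n) → ℤ) →
  sumSubsets (suc n) f ≡ sumSubsets n (λ z → f (outside ∷ z)) + sumSubsets n (λ z → f (inside ∷ z))
sumSubsets-suc n f = begin
  sumList (map (outside ∷_) (allSubsets n) ++ map (inside ∷_) (allSubsets n)) f
    ≡⟨ sumList-++ (map (outside ∷_) (allSubsets n)) _ f ⟩
  sumList (map (outside ∷_) (allSubsets n)) f + sumList (map (inside ∷_) (allSubsets n)) f
    ≡⟨ cong₂ _+_ (sumList-map (outside ∷_) (allSubsets n) f) (sumList-map (inside ∷_) (allSubsets n) f) ⟩
  sumSubsets n (λ z → f (outside ∷ z)) + sumSubsets n (λ z → f (inside ∷ z)) ∎
  where open ≡-Reasoning

sumSubsets-insertAt : ∀ {n} (v : Fin (suc n)) (f : Subset (suc n) → ℤ) →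
  sumSubsets (suc n) f ≡ sumSubsets n (λ z → f (insertAt z v outside) + f (insertAt z v inside))
sumSubsets-insertAt {n} zero f =
  trans (sumSubsets-suc n f) (sym (sumList-+ (allSubsets n) (λ z → f (outside ∷ z)) (λ z → f (inside ∷ z))))
sumSubsets-insertAt {suc n} (suc v) f = begin
  sumSubsets (suc (suc n)) f
    ≡⟨ sumSubsets-suc (suc n) f ⟩
  sumSubsets (suc n) (λ z → f (outside ∷ z)) + sumSubsets (suc n) (λ z → f (inside ∷ z))
    ≡⟨ cong₂ _+_ (sumSubsets-insertAt v (λ z → f (outside ∷ z))) (sumSubsets-insertAt v (λ z → f (inside ∷ z))) ⟩
  sumSubsets n (λ z → g (outside ∷ z)) + sumSubsets n (λ z → g (inside ∷ z))
    ≡⟨ sumSubsets-suc n g ⟨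
  sumSubsets (suc n) g ∎
  where
  open ≡-Reasoning
  g : Subset (suc n) → ℤ
  g z = f (insertAt z (suc v) outside) + f (insertAt z (suc v) inside)

∈-allSubsets : ∀ n (z : Subset n) → z ∈ₗ allSubsets n
∈-allSubsets zero [] = Any.here refl
∈-allSubsets (suc n) (outside ∷ z) = ∈-++⁺ˡ (∈-map⁺ (outside ∷_) (∈-allSubsets n z))
∈-allSubsets (suc n) (inside ∷ z) =
  ∈-++⁺ʳ (map (outside ∷_) (allSubsets n)) (∈-map⁺ (inside ∷_) (∈-allSubsets n z))

nonEmpty : ∀ {n} → Subset n → Bool
nonEmpty z = 0 <ᵇ ∣ z ∣

∈⇒nonEmpty : ∀ {n} {v : Fin n} {z : Subset n} → v ∈ z → nonEmpty z ≡ true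
∈⇒nonEmpty here = refl
∈⇒nonEmpty {z = outside ∷ z} (there v∈z) = ∈⇒nonEmpty v∈z
∈⇒nonEmpty {z = inside ∷ z} (there v∈z) = refl

nonEmpty⇒∈ : ∀ {n} (z : Subset n) → nonEmpty z ≡ true → ∃ λ v → v ∈ z
nonEmpty⇒∈ (outside ∷ z) ne = let (v , v∈z) = nonEmpty⇒∈ z ne in suc v , there v∈z
nonEmpty⇒∈ (inside ∷ z) ne = zero , here

∣z∣≡0⇒z≡⊥ : ∀ {n} (z : Subset n) → ∣ z ∣ ≡ 0 → z ≡ ⊥
∣z∣≡0⇒z≡⊥ [] eq = refl
∣z∣≡0⇒z≡⊥ (outside ∷ z) eq = cong (outside ∷_) (∣z∣≡0⇒z≡⊥ z eq)

∣insertAt-outside∣ : ∀ {n} (z : Subset n) (v : Fin (suc n)) → ∣ insertAt z v outside ∣ ≡ ∣ z ∣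
∣insertAt-outside∣ z zero = refl
∣insertAt-outside∣ (outside ∷ z) (suc v) = ∣insertAt-outside∣ z v
∣insertAt-outside∣ (inside ∷ z) (suc v) = cong suc (∣insertAt-outside∣ z v)

∣insertAt-inside∣ : ∀ {n} (z : Subset n) (v : Fin (suc n)) → ∣ insertAt z v inside ∣ ≡ suc ∣ z ∣
∣insertAt-inside∣ z zero = refl
∣insertAt-inside∣ (outside ∷ z) (suc v) = ∣insertAt-inside∣ z v
∣insertAt-inside∣ (inside ∷ z) (suc v) = cong suc (∣insertAt-inside∣ z v)

insertAt-removeAt-∈ : ∀ {n} {v : Fin (suc n)} {x : Subset (suc n)} → v ∈ x →
  insertAt (removeAt x v) v inside ≡ x
insertAt-removeAt-∈ {v = v} {x} v∈x = trans (cong (insertAt (removeAt x v) v) (sym ([]=⇒lookup v∈x)))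
                                             (insertAt-removeAt x v)

insertAt-∪ : ∀ {n} (z w : Subset n) (v : Fin (suc n)) (a b : Bool) →
  insertAt z v a ∪ insertAt w v b ≡ insertAt (z ∪ w) v (a ∨ b)
insertAt-∪ z w zero a b = refl
insertAt-∪ (c ∷ z) (d ∷ w) (suc v) a b = cong (_ ∷_) (insertAt-∪ z w v a b)

does-⊆?-insertAt : ∀ {n} (z w : Subset n) (v : Fin (suc n)) (a : Bool) →
  does (insertAt z v a ⊆? insertAt w v inside) ≡ does (z ⊆? w)
does-⊆?-insertAt z w zero outside = refl
does-⊆?-insertAt z w zero inside = refl
does-⊆?-insertAt (outside ∷ z) (d ∷ w) (suc v) a = does-⊆?-insertAt z w v a
does-⊆?-insertAt (inside ∷ z) (outside ∷ w) (suc v) a = refl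
does-⊆?-insertAt (inside ∷ z) (inside ∷ w) (suc v) a = does-⊆?-insertAt z w v a

insertAt-⊆?-inside : ∀ {n} (z w : Subset n) (v : Fin (suc n)) (a : Bool) →
  ⌊ insertAt z v a ⊆? insertAt w v inside ⌋ ≡ ⌊ z ⊆? w ⌋
insertAt-⊆?-inside z w v a = trans (isYes≗does _) (trans (does-⊆?-insertAt z w v a) (sym (isYes≗does _)))

χ-cong : ∀ {n} {A B : Family n} → (∀ z → A z ≡ B z) → χ A ≡ χ B
χ-cong {n} A≗B = sumList-cong (allSubsets n) (λ z → cong (λ b → if b then ω z else 0ℤ) (A≗B z))

-- The summand of χ (λ z → b ∧ nonEmpty z) at a subset z with ∣ z ∣ = k.
signedTerm : Bool → ℕ → ℤ
signedTerm b k = if b ∧ (0 <ᵇ k) then (-1ℤ) ^ (k ∸ 1) else 0ℤ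

signedTerm-pair : ∀ b k → (k ≡ 0 → b ≡ true) →
  signedTerm b k + signedTerm b (suc k) ≡ (if 0 <ᵇ k then 0ℤ else 1ℤ)
signedTerm-pair b zero k≡0⇒b rewrite k≡0⇒b refl = refl
signedTerm-pair false (suc k) _ = refl
signedTerm-pair true (suc k) _ =
  trans (cong ((-1ℤ) ^ k +_) (ℤ.-1*i≡-i ((-1ℤ) ^ k))) (ℤ.+-inverseʳ ((-1ℤ) ^ k))

sumSubsets-empty : ∀ n → sumSubsets n (λ z → if nonEmpty z then 0ℤ else 1ℤ) ≡ 1ℤ
sumSubsets-empty zero = refl
sumSubsets-empty (suc n) = begin
  sumSubsets (suc n) isEmpty
    ≡⟨ sumSubsets-insertAt {n} zero isEmpty ⟩
  sumSubsets n (λ z → isEmpty z + 0ℤ)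
    ≡⟨ sumList-cong (allSubsets n) (λ z → ℤ.+-identityʳ (isEmpty z)) ⟩
  sumSubsets n isEmpty
    ≡⟨ sumSubsets-empty n ⟩
  1ℤ ∎
  where
  open ≡-Reasoning
  isEmpty : ∀ {m} → Subset m → ℤ
  isEmpty z = if nonEmpty z then 0ℤ else 1ℤ

-- Toggling v pairs z with z ∪ {v}; the two terms cancel unless z = ∅.
χ-cone : ∀ {n} (v : Fin (suc n)) (P : Family (suc n)) →
  (∀ z → P (insertAt z v outside) ≡ P (insertAt z v inside)) → P (insertAt ⊥ v inside) ≡ true →
  χ (λ z → P z ∧ nonEmpty z) ≡ 1ℤ
χ-cone {n} v P toggle apex = begin
  χ (λ z → P z ∧ nonEmpty z)
    ≡⟨ sumSubsets-insertAt v (λ z → signedTerm (P z) ∣ z ∣) ⟩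
  sumSubsets n (λ z → signedTerm (P (insertAt z v outside)) ∣ insertAt z v outside ∣
                    + signedTerm (P (insertAt z v inside)) ∣ insertAt z v inside ∣)
    ≡⟨ sumList-cong (allSubsets n) pair ⟩
  sumSubsets n (λ z → if nonEmpty z then 0ℤ else 1ℤ)
    ≡⟨ sumSubsets-empty n ⟩
  1ℤ ∎
  where
  open ≡-Reasoning
  pair : ∀ z → signedTerm (P (insertAt z v outside)) ∣ insertAt z v outside ∣
             + signedTerm (P (insertAt z v inside)) ∣ insertAt z v inside ∣
             ≡ (if nonEmpty z then 0ℤ else 1ℤ)
  pair z = trans (cong₂ _+_ (cong₂ signedTerm (toggle z) (∣insertAt-outside∣ z v))
                            (cong (signedTerm _) (∣insertAt-inside∣ z v)))
                 (signedTerm-pair (P (insertAt z v inside)) ∣ z ∣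
                   (λ ∣z∣≡0 → trans (cong (λ w → P (insertAt w v inside)) (∣z∣≡0⇒z≡⊥ z ∣z∣≡0)) apex))

-- Stars and unit spheres

true⇔true⇒≡ : ∀ {a b : Bool} → (a ≡ true → b ≡ true) → (b ≡ true → a ≡ true) → a ≡ b
true⇔true⇒≡ {true} a⇒b b⇒a = sym (a⇒b refl)
true⇔true⇒≡ {false} {true} a⇒b b⇒a = b⇒a refl
true⇔true⇒≡ {false} {false} a⇒b b⇒a = refl

⊆?-complete : ∀ {n} {x y : Subset n} → x ⊆ y → ⌊ x ⊆? y ⌋ ≡ true
⊆?-complete {x = x} {y} x⊆y = trans (isYes≗does (x ⊆? y)) (dec-true (x ⊆? y) x⊆y)

⊆?-sound : ∀ {n} {x y : Subset n} → ⌊ x ⊆? y ⌋ ≡ true → x ⊆ y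
⊆?-sound {x = x} {y} eq = toWitness {a? = x ⊆? y} (from T-≡ eq)

module _ {n} {G : Family n} (complex : IsComplex G) where

  simplex-nonEmpty : ∀ {x} → G x ≡ true → nonEmpty x ≡ true
  simplex-nonEmpty Gx = ∈⇒nonEmpty (proj₂ (proj₁ complex _ Gx))

  face-simplex : ∀ {x y} → G y ≡ true → x ⊆ y → nonEmpty x ≡ true → G x ≡ true
  face-simplex {x} Gy x⊆y ne = proj₂ complex _ x Gy x⊆y (nonEmpty⇒∈ x ne)

  U⊆Ubar : ∀ x z → U G x z ≡ true → Ubar G x z ≡ true
  U⊆Ubar x z Uz = cong₂ _∧_ (∧-conicalˡ _ _ Uz)
    (to T-≡ (any⁺ _ (lose (∈-allSubsets n z) (from T-≡ (cong₂ _∧_ Uz (⊆?-complete (λ z∈ → z∈)))))))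

  Ubar≡cone : ∀ {x} → G x ≡ true → ∀ z → Ubar G x z ≡ G (z ∪ x) ∧ nonEmpty z
  Ubar≡cone {x} Gx z = true⇔true⇒≡ ⇒cone cone⇒
    where
    ⇒cone : Ubar G x z ≡ true → G (z ∪ x) ∧ nonEmpty z ≡ true
    ⇒cone Ubar-z with Any.satisfied (any⁻ _ (allSubsets n) (from T-≡ (∧-conicalʳ _ _ Ubar-z)))
    ... | y , Uy∧z⊆y =
      let Uy∧z⊆y = to T-≡ Uy∧z⊆y
          Gy∧x⊆y = ∧-conicalˡ _ _ Uy∧z⊆y
          x⊆y = ⊆?-sound (∧-conicalʳ _ _ Gy∧x⊆y)
          z⊆y = ⊆?-sound (∧-conicalʳ _ _ Uy∧z⊆y)
          ne = simplex-nonEmpty (∧-conicalˡ _ _ Ubar-z)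
      in cong₂ _∧_ (face-simplex (∧-conicalˡ _ _ Gy∧x⊆y) ([ z⊆y , x⊆y ]′ ∘ x∈p∪q⁻ z x)
                     (∈⇒nonEmpty (p⊆p∪q x (proj₂ (nonEmpty⇒∈ z ne)))))
                   ne
    cone⇒ : G (z ∪ x) ∧ nonEmpty z ≡ true → Ubar G x z ≡ true
    cone⇒ G[z∪x]∧ne =
      let G[z∪x] = ∧-conicalˡ _ _ G[z∪x]∧ne
          ne = ∧-conicalʳ _ _ G[z∪x]∧ne
          U[z∪x] = cong₂ _∧_ G[z∪x] (⊆?-complete (q⊆p∪q z x))
      in cong₂ _∧_ (face-simplex G[z∪x] (p⊆p∪q x) ne)
                   (to T-≡ (any⁺ _ (lose (∈-allSubsets n (z ∪ x))
                                         (from T-≡ (cong₂ _∧_ U[z∪x] (⊆?-complete (p⊆p∪q x)))))))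

χ-split : ∀ {n} (A B : Family n) → (∀ z → A z ≡ true → B z ≡ true) →
  χ A + χ (λ z → B z ∧ not (A z)) ≡ χ B
χ-split {n} A B A⊆B = trans (sym (sumList-+ (allSubsets n) (λ z → if A z then ω z else 0ℤ)
                                                              (λ z → if B z ∧ not (A z) then ω z else 0ℤ)))
                            (sumList-cong (allSubsets n) (λ z → indicator-split (A z) (B z) (ω z) (A⊆B z)))
  where
  indicator-split : ∀ a b (w : ℤ) → (a ≡ true → b ≡ true) →
    (if a then w else 0ℤ) + (if b ∧ not a then w else 0ℤ) ≡ (if b then w else 0ℤ)
  indicator-split true b w a⇒b rewrite a⇒b refl = ℤ.+-identityʳ w
  indicator-split false true w _ = ℤ.+-identityˡ w
  indicator-split false false w _ = refl

χ-join≡1 : ∀ {n} (G : Family (suc n)) {v : Fin (suc n)} {x : Subset (suc n)} → v ∈ x → G x ≡ true →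
  χ (λ z → G (z ∪ x) ∧ nonEmpty z) ≡ 1ℤ
χ-join≡1 G {v} {x} v∈x Gx = χ-cone v (λ z → G (z ∪ x)) toggle apex
  where
  x′ = removeAt x v
  absorb : ∀ a z → insertAt z v a ∪ x ≡ insertAt (z ∪ x′) v inside
  absorb a z = begin
    insertAt z v a ∪ x                      ≡⟨ cong (insertAt z v a ∪_) (insertAt-removeAt-∈ v∈x) ⟨
    insertAt z v a ∪ insertAt x′ v inside    ≡⟨ insertAt-∪ z x′ v a inside ⟩
    insertAt (z ∪ x′) v (a ∨ inside)         ≡⟨ cong (insertAt (z ∪ x′) v) (∨-zeroʳ a) ⟩
    insertAt (z ∪ x′) v inside ∎
    where open ≡-Reasoning
  toggle : ∀ z → G (insertAt z v outside ∪ x) ≡ G (insertAt z v inside ∪ x)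
  toggle z = cong G (trans (absorb outside z) (sym (absorb inside z)))
  apex : G (insertAt ⊥ v inside ∪ x) ≡ true
  apex = trans (cong G (trans (absorb inside ⊥)
                              (trans (cong (λ w → insertAt w v inside) (∪-identityˡ x′)) (insertAt-removeAt-∈ v∈x))))
               Gx

χ-faces≡1 : ∀ {n} {v : Fin (suc n)} {y : Subset (suc n)} → v ∈ y →
  χ (λ x → ⌊ x ⊆? y ⌋ ∧ nonEmpty x) ≡ 1ℤ
χ-faces≡1 {v = v} {y} v∈y = χ-cone v (λ x → ⌊ x ⊆? y ⌋) toggle apex
  where
  y′ = removeAt y v
  y≡ = insertAt-removeAt-∈ v∈y
  ⊆y⇔⊆y′ : ∀ a z → ⌊ insertAt z v a ⊆? y ⌋ ≡ ⌊ z ⊆? y′ ⌋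
  ⊆y⇔⊆y′ a z = trans (cong (λ w → ⌊ insertAt z v a ⊆? w ⌋) (sym y≡)) (insertAt-⊆?-inside z y′ v a)
  toggle : ∀ z → ⌊ insertAt z v outside ⊆? y ⌋ ≡ ⌊ insertAt z v inside ⊆? y ⌋
  toggle z = trans (⊆y⇔⊆y′ outside z) (sym (⊆y⇔⊆y′ inside z))
  apex : ⌊ insertAt ⊥ v inside ⊆? y ⌋ ≡ true
  apex = trans (⊆y⇔⊆y′ inside ⊥) (⊆?-complete ⊥⊆)

χ-star+χ-sphere≡1 : ∀ {n} {G : Family (suc n)} → IsComplex G → ∀ {x} → G x ≡ true →
  χ (U G x) + χ (S G x) ≡ 1ℤ
χ-star+χ-sphere≡1 {G = G} complex {x} Gx = begin
  χ (U G x) + χ (S G x)                ≡⟨ χ-split (U G x) (Ubar G x) (U⊆Ubar complex x) ⟩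
  χ (Ubar G x)                         ≡⟨ χ-cong (Ubar≡cone complex Gx) ⟩
  χ (λ z → G (z ∪ x) ∧ nonEmpty z)     ≡⟨ χ-join≡1 G (proj₂ (proj₁ complex x Gx)) Gx ⟩
  1ℤ ∎
  where open ≡-Reasoning

-- Double counting

sum-ω*χ-star≡χ : ∀ {n} {G : Family (suc n)} → IsComplex G →
  sumSubsets (suc n) (λ x → if G x then ω x * χ (U G x) else 0ℤ) ≡ χ G
sum-ω*χ-star≡χ {n} {G} complex = begin
  sumSubsets N (λ x → if G x then ω x * χ (U G x) else 0ℤ)
    ≡⟨ sumList-cong (allSubsets N) (λ x → if-*ʳ (G x) (ω x) (χ (U G x))) ⟩
  sumSubsets N (λ x → ωG x * χ (U G x))
    ≡⟨ sumList-cong (allSubsets N) (λ x → sym (sumList-*ˡ (allSubsets N) (ωG x) _)) ⟩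
  sumSubsets N (λ x → sumSubsets N (λ y → pair x y))
    ≡⟨ sumList-comm (allSubsets N) (allSubsets N) pair ⟩
  sumSubsets N (λ y → sumSubsets N (λ x → pair x y))
    ≡⟨ sumList-cong (allSubsets N) (λ y → faces y (G y) refl) ⟩
  χ G ∎
  where
  open ≡-Reasoning
  N = suc n
  ωG : Subset N → ℤ
  ωG x = if G x then ω x else 0ℤ
  pair : Subset N → Subset N → ℤ
  pair x y = ωG x * (if U G x y then ω y else 0ℤ)
  if-*ʳ : ∀ b (w c : ℤ) → (if b then w * c else 0ℤ) ≡ (if b then w else 0ℤ) * c
  if-*ʳ true w c = refl
  if-*ʳ false w c = sym (ℤ.*-zeroˡ c)
  face-term : ∀ (g s e : Bool) (w w′ : ℤ) → (s ≡ true → g ≡ e) →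
    (if g then w else 0ℤ) * (if s then w′ else 0ℤ) ≡ (if s ∧ e then w else 0ℤ) * w′
  face-term g false e w w′ _ = trans (ℤ.*-zeroʳ (if g then w else 0ℤ)) (sym (ℤ.*-zeroˡ w′))
  face-term g true e w w′ g≡e rewrite g≡e refl = refl
  faces : ∀ y b → b ≡ G y →
    sumSubsets N (λ x → ωG x * (if b ∧ ⌊ x ⊆? y ⌋ then ω y else 0ℤ))
      ≡ (if b then ω y else 0ℤ)
  faces y false _ = trans (sumList-cong (allSubsets N) (λ x → ℤ.*-zeroʳ (ωG x)))
                          (sumList-0 (allSubsets N))
  faces y true Gy = begin
    sumSubsets N (λ x → ωG x * (if ⌊ x ⊆? y ⌋ then ω y else 0ℤ))
      ≡⟨ sumList-cong (allSubsets N) (λ x → face-term (G x) ⌊ x ⊆? y ⌋ (nonEmpty x) (ω x) (ω y) (G≡nonEmpty x)) ⟩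
    sumSubsets N (λ x → (if ⌊ x ⊆? y ⌋ ∧ nonEmpty x then ω x else 0ℤ) * ω y)
      ≡⟨ sumList-*ʳ (allSubsets N) (ω y) (λ x → if ⌊ x ⊆? y ⌋ ∧ nonEmpty x then ω x else 0ℤ) ⟩
    χ (λ x → ⌊ x ⊆? y ⌋ ∧ nonEmpty x) * ω y
      ≡⟨ cong (_* ω y) (χ-faces≡1 (proj₂ (proj₁ complex y (sym Gy)))) ⟩
    1ℤ * ω y
      ≡⟨ ℤ.*-identityˡ (ω y) ⟩
    ω y ∎
    where
    G≡nonEmpty : ∀ x → ⌊ x ⊆? y ⌋ ≡ true → G x ≡ nonEmpty x
    G≡nonEmpty x x⊆y = true⇔true⇒≡ (simplex-nonEmpty complex)
                                    (face-simplex complex (sym Gy) (⊆?-sound x⊆y))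

χ≡c*χ : ∀ {n} {G : Family (suc n)} → IsComplex G → (c : ℤ) → (∀ x → G x ≡ true → χ (U G x) ≡ c) →
  χ G ≡ c * χ G
χ≡c*χ {n} {G} complex c χ-star≡c = begin
  χ G                                                             ≡⟨ sum-ω*χ-star≡χ complex ⟨
  sumSubsets (suc n) (λ x → if G x then ω x * χ (U G x) else 0ℤ)   ≡⟨ sumList-cong (allSubsets (suc n)) term ⟩
  sumSubsets (suc n) (λ x → c * (if G x then ω x else 0ℤ))         ≡⟨ sumList-*ˡ (allSubsets (suc n)) c _ ⟩
  c * χ G ∎
  where
  open ≡-Reasoning
  term : ∀ x → (if G x then ω x * χ (U G x) else 0ℤ) ≡ c * (if G x then ω x else 0ℤ)
  term x with G x in Gx
  ... | true = trans (cong (ω x *_) (χ-star≡c x Gx)) (ℤ.*-comm (ω x) c)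
  ... | false = sym (ℤ.*-zeroʳ c)

-1^even≡1 : ∀ q → suc q % 2 ≡ 1 → (-1ℤ) ^ q ≡ 1ℤ
-1^even≡1 zero _ = refl
-1^even≡1 (suc (suc q)) odd = cong (λ t → -1ℤ * (-1ℤ * t)) (-1^even≡1 q odd)

i≡-i⇒i≡0 : ∀ i → i ≡ - i → i ≡ 0ℤ
i≡-i⇒i≡0 +0 _ = refl
i≡-i⇒i≡0 +[1+ k ] ()
i≡-i⇒i≡0 -[1+ k ] ()

mainTheorem1 : (q : ℕ) → q % 2 ≡ 1 → (n : ℕ) → (G : Family n) → IsComplex G →
    DSManifold q G → χ G ≡ 0ℤ × DSSphere (suc q) G
mainTheorem1 zero () n G complex manifold
mainTheorem1 (suc q) odd zero G complex ((x , Gx) , _) with proj₁ complex x Gx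
... | () , _
mainTheorem1 (suc q) odd (suc n) G complex manifold@(_ , spheres) =
  χG≡0 , manifold , trans χG≡0 (cong (λ t → 1ℤ + -1ℤ * t) (sym even))
  where
  even : (-1ℤ) ^ q ≡ 1ℤ
  even = -1^even≡1 q odd
  χ-sphere≡2 : ∀ x → G x ≡ true → χ (S G x) ≡ 1ℤ + 1ℤ
  χ-sphere≡2 x Gx = trans (proj₂ (spheres x Gx)) (cong (1ℤ +_) even)
  χ-star≡-1 : ∀ x → G x ≡ true → χ (U G x) ≡ -1ℤ
  χ-star≡-1 x Gx = ∙-cancelʳ (1ℤ + 1ℤ) (χ (U G x)) -1ℤ
    (trans (cong (χ (U G x) +_) (sym (χ-sphere≡2 x Gx))) (χ-star+χ-sphere≡1 complex Gx))
  χG≡0 : χ G ≡ 0ℤ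
  χG≡0 = i≡-i⇒i≡0 (χ G) (trans (χ≡c*χ complex -1ℤ χ-star≡-1) (ℤ.-1*i≡-i (χ G)))
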